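{- Let $A$ be a finite set of atoms, $P$ a propositional Horn theory over $A$ and $I\subseteq A$. Let $I^\oplus=\{a\leftarrow(\{a\}\cup I)\mid a\in A\}$. Then $$P\circ I^\oplus=facts(P)\cup\{head(r)\leftarrow(body(r)\cup I)\mid r\in proper(P)\}.$$
   Context: A theory over $A$ is a finite set of rules $a_0\leftarrow a_1,\ldots,a_k$ ($k\ge0$, $a_i\in A$), with $head(r)=\{a_0\}$, $body(r)=\{a_1,\ldots,a_k\}$ (a rule is determined by its head atom and body set), size $k$; $head(S),body(S)$ are unions over a set $S$ of rules. A fact is a rule with empty body, a proper rule is one that is not a fact; $facts(P)$, $proper(P)$ denote the facts and proper rules of $P$. Write $S\subseteq_r R$ if $S\subseteq R$ has as many elements as the size of $r$. Composition: $P\circ R=\{head(r)\leftarrow body(S)\mid r\in P,\ S\subseteq_r R,\ head(S)=body(r)\}$. -}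

module Defs where

open import Data.Nat using (ℕ)
open import Data.Fin using (Fin)
open import Data.Fin.Subset using (Subset; ⊥; ⁅_⁆; _∪_; ⋃; ∣_∣)
open import Data.List using (List; map; length)
open import Data.List.Relation.Unary.All using (All)
open import Data.List.Relation.Unary.Unique.Propositional using (Unique)
open import Data.Product using (Σ; ∃; _×_; _,_)
open import Data.Sum using (_⊎_)
open import Relation.Binary.PropositionalEquality using (_≡_)
open import Relation.Nullary using (¬_)
open import Level using (0ℓ; suc)

-- Atoms: the finite set A is Fin n.
-- A rule a₀ ← a₁,…,aₖ is determined by its head atom and body set.
record Rule (n : ℕ) : Set where
  constructor _←_
  field
    hd : Fin n
    bd : Subset n
open Rule public

size : ∀ {n} → Rule n → ℕ
size r = ∣ bd r ∣

-- A theory (set of rules) is given by its membership predicate.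
-- (Rule n is a finite type, so every such set is finite.)
Theory : ℕ → Set₁
Theory n = Rule n → Set

heads : ∀ {n} → List (Rule n) → Subset n
heads S = ⋃ (map (λ r → ⁅ hd r ⁆) S)

bodies : ∀ {n} → List (Rule n) → Subset n
bodies S = ⋃ (map bd S)

_⊆[_]_ : ∀ {n} → List (Rule n) → Rule n → Theory n → Set
S ⊆[ r ] R = Unique S × All R S × length S ≡ size r

_∘ₜ_ : ∀ {n} → Theory n → Theory n → Theory n
(P ∘ₜ R) r' = Σ (Rule _) λ r → P r × Σ (List (Rule _)) λ S →
  S ⊆[ r ] R × heads S ≡ bd r × r' ≡ (hd r ← bodies S)

isFact : ∀ {n} → Rule n → Set
isFact r = bd r ≡ ⊥

facts : ∀ {n} → Theory n → Theory n
facts P r = P r × isFact r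

proper : ∀ {n} → Theory n → Theory n
proper P r = P r × ¬ isFact r

_⊕ : ∀ {n} → Subset n → Theory n
(I ⊕) r = Σ (Fin _) λ a → r ≡ (a ← (⁅ a ⁆ ∪ I))

rhs : ∀ {n} → Theory n → Subset n → Theory n
rhs P I r' = facts P r' ⊎ Σ (Rule _) λ r → proper P r × r' ≡ (hd r ← (bd r ∪ I))

_≐_ : ∀ {n} → Theory n → Theory n → Set
P ≐ Q = ∀ r → (P r → Q r) × (Q r → P r)

-- A rule of I^⊕ has body {a} ∪ I, so a nonempty set S of such rules has
-- body(S) = head(S) ∪ I, while the empty set has empty head and body.  Hence
-- the facts of P compose with S = ∅ and are kept unchanged, and a proper rule
-- r composes exactly with the rules a ← {a} ∪ I for a ∈ body(r), which turn it
-- into head(r) ← body(r) ∪ I.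
module Submission where

open import Defs
open import Data.Nat using (ℕ)
open import Data.Fin.Subset using (Subset)

open import Data.Fin using (Fin; zero; suc)
open import Data.Fin.Properties using (suc-injective)
open import Data.Fin.Subset using (⊥; ⁅_⁆; _∪_; ⋃; ∣_∣; inside; outside; _∈_)
open import Data.Fin.Subset.Properties
  using (∪-identityˡ; ∪-identityʳ; ∣⊥∣≡0; ∉⊥; x∈⁅x⁆; p⊆p∪q; ∪-idempotentCommutativeMonoid)
open import Data.Vec using ([]; _∷_)
open import Data.List using (List; []; _∷_; map; length)
open import Data.List.Properties using (length-map; map-∘)
open import Data.List.Relation.Unary.All using (All; []; _∷_; universal)
import Data.List.Relation.Unary.All.Properties as All
open import Data.List.Relation.Unary.AllPairs using ([]; _∷_)
open import Data.List.Relation.Unary.Unique.Propositional using (Unique)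
import Data.List.Relation.Unary.Unique.Propositional.Properties as Unique
open import Data.Product using (Σ; _×_; _,_)
open import Data.Sum using (inj₁; inj₂)
open import Relation.Binary.PropositionalEquality
  using (_≡_; _≢_; refl; sym; trans; cong; subst)
open import Relation.Nullary using (contradiction)

elements : ∀ {n} → Subset n → List (Fin n)
elements []            = []
elements (inside  ∷ p) = zero ∷ map suc (elements p)
elements (outside ∷ p) = map suc (elements p)

elements-unique : ∀ {n} (p : Subset n) → Unique (elements p)
elements-unique []            = []
elements-unique (inside  ∷ p) =
  All.map⁺ (universal (λ _ ()) (elements p)) ∷ Unique.map⁺ suc-injective (elements-unique p)
elements-unique (outside ∷ p) = Unique.map⁺ suc-injective (elements-unique p)

length-elements : ∀ {n} (p : Subset n) → length (elements p) ≡ ∣ p ∣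
length-elements []            = refl
length-elements (inside  ∷ p) = cong ℕ.suc (trans (length-map suc (elements p)) (length-elements p))
length-elements (outside ∷ p) = trans (length-map suc (elements p)) (length-elements p)

⋃⁅⁆-map-suc : ∀ {n} (xs : List (Fin n)) → ⋃ (map ⁅_⁆ (map suc xs)) ≡ outside ∷ ⋃ (map ⁅_⁆ xs)
⋃⁅⁆-map-suc []       = refl
⋃⁅⁆-map-suc (x ∷ xs) = cong (⁅ suc x ⁆ ∪_) (⋃⁅⁆-map-suc xs)

⋃⁅⁆-elements : ∀ {n} (p : Subset n) → ⋃ (map ⁅_⁆ (elements p)) ≡ p
⋃⁅⁆-elements []            = refl
⋃⁅⁆-elements (inside  ∷ p) =
  trans (cong (⁅ zero ⁆ ∪_) (⋃⁅⁆-map-suc (elements p)))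
        (cong (inside ∷_) (trans (∪-identityˡ _) (⋃⁅⁆-elements p)))
⋃⁅⁆-elements (outside ∷ p) = trans (⋃⁅⁆-map-suc (elements p)) (cong (outside ∷_) (⋃⁅⁆-elements p))

⁅x⁆∪p≢⊥ : ∀ {n} (x : Fin n) (p : Subset n) → ⁅ x ⁆ ∪ p ≢ ⊥
⁅x⁆∪p≢⊥ x p eq = ∉⊥ (subst (x ∈_) eq (p⊆p∪q p (x∈⁅x⁆ x)))

module _ {n : ℕ} (I : Subset n) where

  open import Algebra.Properties.IdempotentCommutativeMonoid (∪-idempotentCommutativeMonoid n)
    using (∙-distrʳ-∙)

  ⊕-rule : Fin n → Rule n
  ⊕-rule a = a ← (⁅ a ⁆ ∪ I)

  bodies-⊕ : ∀ s S → All (I ⊕) (s ∷ S) → bodies (s ∷ S) ≡ heads (s ∷ S) ∪ I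
  bodies-⊕ s []       ((a , refl) ∷ [])    = trans (∪-identityʳ _) (cong (_∪ I) (sym (∪-identityʳ ⁅ a ⁆)))
  bodies-⊕ s (s′ ∷ S) ((a , refl) ∷ s′S∈I⊕) =
    trans (cong ((⁅ a ⁆ ∪ I) ∪_) (bodies-⊕ s′ S s′S∈I⊕)) (sym (∙-distrʳ-∙ I ⁅ a ⁆ (heads (s′ ∷ S))))

  ⊕-cover : ∀ r → Σ (List (Rule n)) λ S → S ⊆[ r ] (I ⊕) × heads S ≡ bd r
  ⊕-cover r =
    map ⊕-rule xs ,
    ( Unique.map⁺ (cong hd) (elements-unique (bd r))
    , All.map⁺ (universal (λ a → a , refl) xs)
    , trans (length-map ⊕-rule xs) (length-elements (bd r)) ) ,
    trans (cong ⋃ (sym (map-∘ xs))) (⋃⁅⁆-elements (bd r))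
    where xs = elements (bd r)

  module _ (P : Theory n) where

    ∘ₜ-⊕⊆rhs : ∀ r′ → (P ∘ₜ (I ⊕)) r′ → rhs P I r′
    ∘ₜ-⊕⊆rhs _ ((h ← b) , r∈P , []    , _              , refl , refl) = inj₁ (r∈P , refl)
    ∘ₜ-⊕⊆rhs _ ((h ← b) , r∈P , s ∷ S , (_ , S∈I⊕ , _) , refl , refl) =
      inj₂ ((h ← b) , (r∈P , ⁅x⁆∪p≢⊥ (hd s) (heads S)) , cong (h ←_) (bodies-⊕ s S S∈I⊕))

    rhs⊆∘ₜ-⊕ : ∀ r′ → rhs P I r′ → (P ∘ₜ (I ⊕)) r′
    rhs⊆∘ₜ-⊕ (h ← b) (inj₁ (r∈P , refl)) =
      (h ← ⊥) , r∈P , [] , ([] , [] , sym (∣⊥∣≡0 n)) , refl , refl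
    rhs⊆∘ₜ-⊕ _ (inj₂ (r , (r∈P , b≢⊥) , refl)) with ⊕-cover r
    ... | []    , _               , heads≡b = contradiction (sym heads≡b) b≢⊥
    ... | s ∷ S , (u , S∈I⊕ , len) , heads≡b =
      r , r∈P , s ∷ S , (u , S∈I⊕ , len) , heads≡b ,
      cong (hd r ←_) (sym (trans (bodies-⊕ s S S∈I⊕) (cong (_∪ I) heads≡b)))

proposition4p5 : (n : ℕ) (P : Theory n) (I : Subset n) → (P ∘ₜ (I ⊕)) ≐ rhs P I
proposition4p5 n P I r′ = ∘ₜ-⊕⊆rhs I P r′ , rhs⊆∘ₜ-⊕ I P r′
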